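{- Let $p$ be the characteristic of $\mathbb F_q$, let $\Lambda_1=\{[X_1],\dots,[X_N]\}$ be the set of points of $\mathrm{PG}(M_{n+1}(q))$ represented by the rank-one matrices $x\xi$ ($x$ a nonzero column vector, $\xi$ a nonzero row vector in $\mathbb F_q^{n+1}$) with $\xi x=0$, with fixed representatives $X_i$, and let $\mathcal C(\Lambda_1)$ be the associated linear code. Then: (1) If $p\nmid(n+1)$, then $\mathcal C(\Lambda_1)=\{(\mathrm{Tr}(X_1M),\dots,\mathrm{Tr}(X_NM)) : M\in M^0_{n+1}(q)\}$. (2) If $p\mid(n+1)$, then $\mathcal C(\Lambda_1)=\{(\mathrm{Tr}(X_1M),\dots,\mathrm{Tr}(X_NM)) : M=(m_{i,j})\in M_{n+1}(q),\ m_{1,1}=0\}$.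
   Context: $M^0_{n+1}(q)$ is the space of trace-zero matrices. $\mathcal C(\Lambda_1)$ is the code generated by the matrix whose columns are the coordinate vectors of $X_1,\dots,X_N$. -}

module Defs where

open import Level using (Level; _⊔_)
open import Data.Nat as ℕ using (ℕ; zero; suc)
open import Data.Nat.Divisibility using (_∣_)
open import Data.Nat.Primality using (Prime)
open import Data.Fin using (Fin; zero; suc)
open import Data.Product using (Σ; ∃; ∃-syntax; _×_; _,_)
open import Function using (Surjective)
open import Relation.Nullary using (¬_)
open import Relation.Binary.PropositionalEquality using (_≡_)
open import Algebra.Bundles using (CommutativeRing)

module FieldDefs {c ℓ : Level} (R : CommutativeRing c ℓ) where
  open CommutativeRing R hiding (zero)

  IsField : Set (c ⊔ ℓ)
  IsField = (¬ (1# ≈ 0#)) × (∀ x → ¬ (x ≈ 0#) → ∃[ y ] (x * y ≈ 1#))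

  IsFiniteOfSize : ℕ → Set (c ⊔ ℓ)
  IsFiniteOfSize q = Σ (Fin q → Carrier) λ e →
    (∀ i j → e i ≈ e j → i ≡ j) × (∀ y → ∃[ i ] (e i ≈ y))

  ℕ→R : ℕ → Carrier
  ℕ→R zero = 0#
  ℕ→R (suc k) = 1# + ℕ→R k

  HasCharacteristic : ℕ → Set ℓ
  HasCharacteristic p = Prime p × (ℕ→R p ≈ 0#)

  Σ[_]_ : (m : ℕ) → (Fin m → Carrier) → Carrier
  Σ[ zero ] f = 0#
  Σ[ suc m ] f = f zero + Σ[ m ] (λ i → f (suc i))

  Vect : ℕ → Set c
  Vect m = Fin m → Carrier

  Mat : ℕ → Set c
  Mat m = Fin m → Fin m → Carrier

  _≈M_ : ∀ {m} → Mat m → Mat m → Set ℓ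
  A ≈M B = ∀ i j → A i j ≈ B i j

  _·M_ : ∀ {m} → Carrier → Mat m → Mat m
  (λ' ·M A) i j = λ' * A i j

  NonZeroVec : ∀ {m} → Vect m → Set ℓ
  NonZeroVec v = ∃[ k ] ¬ (v k ≈ 0#)

  dot : ∀ {m} → Vect m → Vect m → Carrier
  dot {m} ξ x = Σ[ m ] (λ k → ξ k * x k)

  outer : ∀ {m} → Vect m → Vect m → Mat m
  outer x ξ i j = x i * ξ j

  matMul : ∀ {m} → Mat m → Mat m → Mat m
  matMul {m} A B i j = Σ[ m ] (λ k → A i k * B k j)

  Tr : ∀ {m} → Mat m → Carrier
  Tr {m} A = Σ[ m ] (λ i → A i i)

  InΛ₁ : ∀ {m} → Mat m → Set (c ⊔ ℓ)
  InΛ₁ A = ∃[ x ] ∃[ ξ ] (NonZeroVec x × NonZeroVec ξ × (dot ξ x ≈ 0#) × (A ≈M outer x ξ))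

  -- X : Fin N → Mat m is a list of fixed representatives of exactly the points of Λ₁
  -- (each one is in Λ₁, distinct indices give distinct projective points,
  --  every point of Λ₁ is represented)
  RepresentsΛ₁ : ∀ {m N} → (Fin N → Mat m) → Set (c ⊔ ℓ)
  RepresentsΛ₁ {m} {N} X =
    (∀ i → InΛ₁ (X i)) ×
    (∀ i j → ¬ (i ≡ j) → ¬ (∃[ λ' ] (X i ≈M (λ' ·M X j)))) ×
    (∀ A → InΛ₁ A → ∃[ i ] ∃[ λ' ] (A ≈M (λ' ·M X i)))

  -- the linear code generated by the (m² × N) matrix whose columns are the
  -- coordinate vectors of X₁,…,X_N: its row space
  InCode : ∀ {m N} → (Fin N → Mat m) → Vect N → Set (c ⊔ ℓ)
  InCode {m} {N} X w = Σ (Mat m) λ u → ∀ i →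
    w i ≈ Σ[ m ] (λ a → Σ[ m ] (λ b → u a b * X i a b))

  trWord : ∀ {m N} → (Fin N → Mat m) → Mat m → Vect N
  trWord X M i = Tr (matMul (X i) M)

{-# OPTIONS --safe #-}
-- A word of the row space has coordinates Σ_{a,b} u_{ab} (X_i)_{ab} = Tr (X_i uᵀ),
-- so 𝒞(Λ₁) consists of the words (Tr (X₁ M), …, Tr (X_N M)) for arbitrary M.
-- Each x ξ with ξ x = 0 is traceless, and Tr (X (M + t I)) = Tr (X M) + t Tr X,
-- so M and M + t I give the same word. Hence M may be normalised: to trace zero
-- by t = - Tr M / (n + 1) when p ∤ n + 1 (then n + 1 is invertible in F), and
-- always to m₁₁ = 0 by t = - m₁₁.
module Submission where

open import Defs
open import Data.Nat using (ℕ; zero; suc)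
open import Data.Nat.Divisibility using (_∣_)
open import Data.Fin using (Fin; zero; suc)
open import Data.Product using (∃-syntax; _×_; _,_)
open import Function using (_⇔_; mk⇔)
open import Relation.Nullary using (¬_; contradiction)
open import Algebra.Bundles using (CommutativeRing)

import Data.Nat as ℕ
open import Data.Nat.Primality using (Prime; prime⇒irreducible)
open import Data.Nat.Coprimality using (Coprime; coprime-Bézout)
open import Data.Nat.GCD using (module Bézout)
open import Data.Sum using (inj₁; inj₂)
open import Relation.Binary.PropositionalEquality as ≡ using (_≡_)

prime∤⇒coprime : ∀ {p k} → Prime p → ¬ (p ∣ k) → Coprime p k
prime∤⇒coprime p-prime p∤k (d∣p , d∣k) with prime⇒irreducible p-prime d∣p
... | inj₁ d≡1   = d≡1
... | inj₂ ≡.refl = contradiction d∣k p∤k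

module ℕ→R-Properties {c ℓ} (R : CommutativeRing c ℓ) where
  open CommutativeRing R hiding (zero)
  open FieldDefs R
  open import Algebra.Properties.Semiring.Mult semiring
    using (×1-homo-*) renaming (_×_ to _×ℕ_)
  open import Relation.Binary.Reasoning.Setoid setoid

  ℕ→R≡×1 : ∀ k → ℕ→R k ≡ k ×ℕ 1#
  ℕ→R≡×1 zero    = ≡.refl
  ℕ→R≡×1 (suc k) = ≡.cong (1# +_) (ℕ→R≡×1 k)

  ℕ→R-homo-* : ∀ a b → ℕ→R (a ℕ.* b) ≈ ℕ→R a * ℕ→R b
  ℕ→R-homo-* a b rewrite ℕ→R≡×1 a | ℕ→R≡×1 b | ℕ→R≡×1 (a ℕ.* b) = ×1-homo-* a b

  ℕ→R-multiple≈0 : ∀ a {b} → ℕ→R b ≈ 0# → ℕ→R (a ℕ.* b) ≈ 0#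
  ℕ→R-multiple≈0 a {b} b≈0 = begin
    ℕ→R (a ℕ.* b)   ≈⟨ ℕ→R-homo-* a b ⟩
    ℕ→R a * ℕ→R b   ≈⟨ *-congˡ b≈0 ⟩
    ℕ→R a * 0#      ≈⟨ zeroʳ _ ⟩
    0#              ∎

  ℕ→R≈0-consecutive⇒1≈0 : ∀ {a b} → suc a ≡ b → ℕ→R a ≈ 0# → ℕ→R b ≈ 0# → 1# ≈ 0#
  ℕ→R≈0-consecutive⇒1≈0 {a} ≡.refl a≈0 b≈0 = begin
    1#          ≈⟨ +-identityʳ 1# ⟨
    1# + 0#     ≈⟨ +-congˡ a≈0 ⟨
    ℕ→R (suc a) ≈⟨ b≈0 ⟩
    0#          ∎

  coprime⇒ℕ→R≉0 : ∀ {p k} → ¬ (1# ≈ 0#) → ℕ→R p ≈ 0# → Coprime p k → ¬ (ℕ→R k ≈ 0#)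
  coprime⇒ℕ→R≉0 1≉0 p≈0 p⊥k k≈0 with coprime-Bézout p⊥k
  ... | Bézout.Identity.+- x y 1+yk≡xp =
    1≉0 (ℕ→R≈0-consecutive⇒1≈0 1+yk≡xp (ℕ→R-multiple≈0 y k≈0) (ℕ→R-multiple≈0 x p≈0))
  ... | Bézout.Identity.-+ x y 1+xp≡yk =
    1≉0 (ℕ→R≈0-consecutive⇒1≈0 1+xp≡yk (ℕ→R-multiple≈0 x p≈0) (ℕ→R-multiple≈0 y k≈0))

module MatrixProperties {c ℓ} (R : CommutativeRing c ℓ) where
  open CommutativeRing R hiding (zero)
  open FieldDefs R
  open import Algebra.Properties.Semiring.Sum semiring
    using (sum; sum-cong-≋; ∑-distrib-+; *-distribˡ-sum; sum-replicate-zero)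
  open import Algebra.Properties.CommutativeSemigroup *-commutativeSemigroup
    using (x∙yz≈y∙xz)
  open import Algebra.Properties.Ring ring using (-‿distribˡ-*)
  open import Relation.Binary.Reasoning.Setoid setoid

  Σ≡sum : ∀ m (f : Vect m) → Σ[ m ] f ≡ sum f
  Σ≡sum zero    f = ≡.refl
  Σ≡sum (suc m) f = ≡.cong (f zero +_) (Σ≡sum m (λ i → f (suc i)))

  Σ-cong : ∀ {m} {f g : Vect m} → (∀ i → f i ≈ g i) → Σ[ m ] f ≈ Σ[ m ] g
  Σ-cong {m} {f} {g} f≈g rewrite Σ≡sum m f | Σ≡sum m g = sum-cong-≋ f≈g

  Σ-distrib-+ : ∀ {m} (f g : Vect m) → Σ[ m ] (λ i → f i + g i) ≈ Σ[ m ] f + Σ[ m ] g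
  Σ-distrib-+ {m} f g
    rewrite Σ≡sum m f | Σ≡sum m g | Σ≡sum m (λ i → f i + g i) = ∑-distrib-+ f g

  *-distribˡ-Σ : ∀ {m} t (f : Vect m) → t * Σ[ m ] f ≈ Σ[ m ] (λ i → t * f i)
  *-distribˡ-Σ {m} t f
    rewrite Σ≡sum m f | Σ≡sum m (λ i → t * f i) = *-distribˡ-sum t f

  Σ-zero : ∀ {m} {f : Vect m} → (∀ i → f i ≈ 0#) → Σ[ m ] f ≈ 0#
  Σ-zero {m} f≈0 = trans (Σ-cong f≈0) (trans (reflexive (Σ≡sum m (λ _ → 0#))) (sum-replicate-zero m))

  I : ∀ {m} → Mat m
  I zero    zero    = 1#
  I zero    (suc _) = 0#
  I (suc _) zero    = 0#
  I (suc i) (suc j) = I i j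

  _+M_ : ∀ {m} → Mat m → Mat m → Mat m
  (A +M B) i j = A i j + B i j

  transpose : ∀ {m} → Mat m → Mat m
  transpose A i j = A j i

  Σ-*-I : ∀ {m} (f : Vect m) j → Σ[ m ] (λ k → f k * I k j) ≈ f j
  Σ-*-I {suc m} f zero = trans (+-cong (*-identityʳ _) (Σ-zero {m} (λ _ → zeroʳ _))) (+-identityʳ _)
  Σ-*-I f (suc j)      = trans (+-cong (zeroʳ _) (Σ-*-I (λ k → f (suc k)) j)) (+-identityˡ _)

  matMul-identityʳ : ∀ {m} (A : Mat m) → matMul A I ≈M A
  matMul-identityʳ A i = Σ-*-I (A i)

  matMul-distribˡ-+M : ∀ {m} (A B C : Mat m) → matMul A (B +M C) ≈M (matMul A B +M matMul A C)
  matMul-distribˡ-+M {m} A B C i j =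
    trans (Σ-cong {m} (λ k → distribˡ _ _ _)) (Σ-distrib-+ (λ k → A i k * B k j) (λ k → A i k * C k j))

  matMul-·M : ∀ {m} (A B : Mat m) t → matMul A (t ·M B) ≈M (t ·M matMul A B)
  matMul-·M {m} A B t i j =
    trans (Σ-cong {m} (λ k → x∙yz≈y∙xz _ _ _)) (sym (*-distribˡ-Σ t (λ k → A i k * B k j)))

  Tr-cong : ∀ {m} {A B : Mat m} → A ≈M B → Tr A ≈ Tr B
  Tr-cong A≈B = Σ-cong (λ i → A≈B i i)

  Tr-+M : ∀ {m} (A B : Mat m) → Tr (A +M B) ≈ Tr A + Tr B
  Tr-+M A B = Σ-distrib-+ (λ i → A i i) (λ i → B i i)

  Tr-·M : ∀ {m} t (A : Mat m) → Tr (t ·M A) ≈ t * Tr A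
  Tr-·M t A = sym (*-distribˡ-Σ t (λ i → A i i))

  Tr-I : ∀ m → Tr (I {m}) ≈ ℕ→R m
  Tr-I zero    = refl
  Tr-I (suc m) = +-congˡ (Tr-I m)

  Tr-outer : ∀ {m} (x ξ : Vect m) → Tr (outer x ξ) ≈ dot ξ x
  Tr-outer x ξ = Σ-cong (λ i → *-comm (x i) (ξ i))

  InΛ₁⇒Tr≈0 : ∀ {m} {A : Mat m} → InΛ₁ A → Tr A ≈ 0#
  InΛ₁⇒Tr≈0 (x , ξ , _ , _ , ξx≈0 , A≈xξ) = trans (Tr-cong A≈xξ) (trans (Tr-outer x ξ) ξx≈0)

  Tr-shift : ∀ {m} (M : Mat m) t → Tr (M +M (t ·M I)) ≈ Tr M + t * ℕ→R m
  Tr-shift {m} M t = trans (Tr-+M M (t ·M I)) (+-congˡ (trans (Tr-·M t (I {m})) (*-congˡ (Tr-I m))))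

  Tr-matMul-shift : ∀ {m} (A M : Mat m) t →
                    Tr (matMul A (M +M (t ·M I))) ≈ Tr (matMul A M) + t * Tr A
  Tr-matMul-shift A M t = begin
    Tr (matMul A (M +M (t ·M I)))                ≈⟨ Tr-cong (matMul-distribˡ-+M A M (t ·M I)) ⟩
    Tr (matMul A M +M matMul A (t ·M I))         ≈⟨ Tr-+M (matMul A M) (matMul A (t ·M I)) ⟩
    Tr (matMul A M) + Tr (matMul A (t ·M I))     ≈⟨ +-congˡ (Tr-cong (matMul-·M A I t)) ⟩
    Tr (matMul A M) + Tr (t ·M matMul A I)       ≈⟨ +-congˡ (Tr-·M t (matMul A I)) ⟩
    Tr (matMul A M) + t * Tr (matMul A I)        ≈⟨ +-congˡ (*-congˡ (Tr-cong (matMul-identityʳ A))) ⟩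
    Tr (matMul A M) + t * Tr A                   ∎

  Tr-matMul-transpose : ∀ {m} (A U : Mat m) →
                        Tr (matMul A (transpose U)) ≈ Σ[ m ] (λ a → Σ[ m ] (λ b → U a b * A a b))
  Tr-matMul-transpose A U = Σ-cong (λ a → Σ-cong (λ b → *-comm (A a b) (U a b)))

  module _ {m N} (X : Fin N → Mat m) (Tr-X≈0 : ∀ i → Tr (X i) ≈ 0#) where

    trWord-shift : ∀ M t i → trWord X (M +M (t ·M I)) i ≈ trWord X M i
    trWord-shift M t i = begin
      trWord X (M +M (t ·M I)) i    ≈⟨ Tr-matMul-shift (X i) M t ⟩
      trWord X M i + t * Tr (X i)   ≈⟨ +-congˡ (trans (*-congˡ (Tr-X≈0 i)) (zeroʳ t)) ⟩
      trWord X M i + 0#             ≈⟨ +-identityʳ _ ⟩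
      trWord X M i                  ∎

    InCode⇔trWord : (Q : Mat m → Set ℓ) → (∀ M → ∃[ t ] Q (M +M (t ·M I))) → ∀ w →
                    InCode X w ⇔ (∃[ M ] (Q M × (∀ i → w i ≈ trWord X M i)))
    InCode⇔trWord Q shift-into-Q w = mk⇔ to from
      where
      to : InCode X w → ∃[ M ] (Q M × (∀ i → w i ≈ trWord X M i))
      to (U , w≈U·X) with shift-into-Q (transpose U)
      ... | t , q = transpose U +M (t ·M I) , q , λ i → begin
        w i                                             ≈⟨ w≈U·X i ⟩
        Σ[ m ] (λ a → Σ[ m ] (λ b → U a b * X i a b))   ≈⟨ Tr-matMul-transpose (X i) U ⟨
        trWord X (transpose U) i                        ≈⟨ trWord-shift (transpose U) t i ⟨
        trWord X (transpose U +M (t ·M I)) i            ∎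

      from : ∃[ M ] (Q M × (∀ i → w i ≈ trWord X M i)) → InCode X w
      from (M , _ , w≈trWord) = transpose M , λ i →
        trans (w≈trWord i) (Tr-matMul-transpose (X i) (transpose M))

  shift-to-Tr≈0 : ∀ {m} → ∃[ v ] (ℕ→R m * v ≈ 1#) → ∀ (M : Mat m) → ∃[ t ] (Tr (M +M (t ·M I)) ≈ 0#)
  shift-to-Tr≈0 {m} (v , mv≈1) M = t , (begin
    Tr (M +M (t ·M I))            ≈⟨ Tr-shift M t ⟩
    Tr M + t * ℕ→R m              ≈⟨ +-congˡ (-‿distribˡ-* _ _) ⟨
    Tr M + - (Tr M * v * ℕ→R m)   ≈⟨ +-congˡ (-‿cong (*-assoc _ _ _)) ⟩
    Tr M + - (Tr M * (v * ℕ→R m)) ≈⟨ +-congˡ (-‿cong (*-congˡ (trans (*-comm v _) mv≈1))) ⟩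
    Tr M + - (Tr M * 1#)          ≈⟨ +-congˡ (-‿cong (*-identityʳ _)) ⟩
    Tr M + - Tr M                 ≈⟨ -‿inverseʳ _ ⟩
    0#                            ∎)
    where
    t : Carrier
    t = - (Tr M * v)

  shift-to-corner≈0 : ∀ {n} (M : Mat (suc n)) → ∃[ t ] ((M +M (t ·M I)) zero zero ≈ 0#)
  shift-to-corner≈0 M = - M zero zero , trans (+-congˡ (*-identityʳ _)) (-‿inverseʳ _)

corollary3p5 : ∀ {c ℓ} (F : CommutativeRing c ℓ) → let open CommutativeRing F hiding (zero) in let open FieldDefs F in
    (q p n N : ℕ) → IsField → IsFiniteOfSize q → HasCharacteristic p →
    (X : Fin N → Mat (suc n)) → RepresentsΛ₁ X →
      ((¬ (p ∣ suc n)) → ∀ (w : Vect N) →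
        InCode X w ⇔ (∃[ M ] ((Tr M ≈ 0#) × (∀ i → w i ≈ trWord X M i))))
      ×
      ((p ∣ suc n) → ∀ (w : Vect N) →
        InCode X w ⇔ (∃[ M ] ((M zero zero ≈ 0#) × (∀ i → w i ≈ trWord X M i))))
corollary3p5 F q p n N (1≉0 , inverse) _ (p-prime , p≈0) X (X∈Λ₁ , _ , _) =
    (λ p∤1+n → InCode⇔trWord X Tr-X≈0 _ (shift-to-Tr≈0 (m-invertible p∤1+n)))
  , (λ _ → InCode⇔trWord X Tr-X≈0 _ shift-to-corner≈0)
  where
  open CommutativeRing F hiding (zero)
  open FieldDefs F
  open ℕ→R-Properties F
  open MatrixProperties F

  Tr-X≈0 : ∀ i → Tr (X i) ≈ 0#
  Tr-X≈0 i = InΛ₁⇒Tr≈0 (X∈Λ₁ i)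

  m-invertible : ¬ (p ∣ suc n) → ∃[ v ] (ℕ→R (suc n) * v ≈ 1#)
  m-invertible p∤1+n = inverse _ (coprime⇒ℕ→R≉0 1≉0 p≈0 (prime∤⇒coprime p-prime p∤1+n))
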